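{- Let $n \ge 1$ and let $T_n = (t_{ij})_{0 \le i,j < n}$ be the $n \times n$ Boolean matrix with $t_{ij} = 1$ if $i < j$ and $t_{ij} = 0$ otherwise. Then $\mathsf{OR_2}(T_n) = n(\lfloor \log_2 n \rfloor + 2) - 2^{\lfloor \log_2 n \rfloor + 1}$.
   Context: A rectifier network with $m$ inputs and $n$ outputs is a tuple $(V,E,\mathsf{in},\mathsf{out})$ where $(V,E)$ is a directed acyclic graph, and $\mathsf{in}\colon\{1,\dots,n\}\to V$ and $\mathsf{out}\colon\{1,\dots,m\}\to V$ are injective maps whose images consist only of sources (respectively, only of sinks) of the graph. Its size is $|E|$. It expresses the Boolean $m\times n$ matrix $M$ with $M_{ij}=1$ iff there is a directed path from $\mathsf{in}(j)$ to $\mathsf{out}(i)$. It has depth $2$ if all maximal paths in the graph have exactly $2$ edges. For a Boolean matrix $A$, $\mathsf{OR_2}(A)$ is the smallest size of a depth-$2$ rectifier network expressing $A$. (Equivalently, $\mathsf{OR_2}(A)$ is the minimum over all collections of 1-rectangles $(R,C)$ of $A$ covering all 1-entries of $A$ of $\sum (|R|+|C|)$.) -}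

module Defs where

open import Data.Bool using (Bool; true; false)
open import Data.Nat using (ℕ; _+_; _≤_)
open import Data.Fin using (Fin; _<?_)
open import Data.Fin.Subset using (Subset; _∈_; ∣_∣)
open import Data.List using (List; map)
open import Data.Nat.ListAction using (sum)
open import Data.List.Relation.Unary.All using (All)
open import Data.List.Relation.Unary.Any using (Any)
open import Data.Product using (_×_; _,_; proj₁; proj₂; Σ)
open import Relation.Binary.PropositionalEquality using (_≡_)
open import Relation.Nullary.Decidable using (does)

BMatrix : ℕ → ℕ → Set
BMatrix m n = Fin m → Fin n → Bool

Rect : ℕ → ℕ → Set
Rect m n = Subset m × Subset n

Is1Rect : ∀ {m n} → BMatrix m n → Rect m n → Set
Is1Rect A (R , C) = ∀ i j → i ∈ R → j ∈ C → A i j ≡ true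

Covers : ∀ {m n} → BMatrix m n → List (Rect m n) → Set
Covers A rs = ∀ i j → A i j ≡ true → Any (λ { (R , C) → i ∈ R × j ∈ C }) rs

IsCover : ∀ {m n} → BMatrix m n → List (Rect m n) → Set
IsCover A rs = All (Is1Rect A) rs × Covers A rs

cost : ∀ {m n} → List (Rect m n) → ℕ
cost rs = sum (map (λ { (R , C) → ∣ R ∣ + ∣ C ∣ }) rs)

OR₂≡ : ∀ {m n} → BMatrix m n → ℕ → Set
OR₂≡ A k = Σ (List (Rect _ _)) (λ rs → IsCover A rs × cost rs ≡ k)
         × (∀ rs → IsCover A rs → k ≤ cost rs)

T : (n : ℕ) → BMatrix n n
T n i j = does (i <? j)

{-# OPTIONS --safe #-}
module Submission where

-- A 1-rectangle (R , C) of T n has R ∩ C = ∅ because T n vanishes on the diagonal. If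
-- point i lies in d i sides of the rectangles of a cover, then cost = ∑ d i, and since
-- every pair i < j lies in R × C for some rectangle, Kraft's inequality ∑ 2^(- d i) ≤ 1
-- holds. Summing the convexity bound k + 2 ≤ d + 2^(k + 1 - d), valid for all k and d,
-- gives n (k + 2) ≤ 2^(k + 1) + cost for every k. Conversely, if 2^k ≤ n ≤ 2^(k + 1),
-- covering the two diagonal blocks of T (⌊n/2⌋ + ⌈n/2⌉) recursively and adding the
-- all-ones corner block (cost n) attains this bound, by induction on k.

open import Defs
open import Data.Nat using (ℕ; _+_; _*_; _∸_; _^_; _≥_)
open import Data.Nat.Logarithm using (⌊log₂_⌋)

open import Data.Nat using (zero; suc; _≤_; _<_; z≤n; s≤s; _≤?_; NonZero; ⌊_/2⌋; ⌈_/2⌉)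
open import Data.Nat.Properties
open import Data.Nat.Induction using (<-rec)
open import Data.Nat.Logarithm using (⌊log₂⌋-mono-≤; ⌊log₂⌊n/2⌋⌋≡⌊log₂n⌋∸1)
open import Data.Nat.ListAction using (sum)
open import Data.Nat.ListAction.Properties using (sum-++)
open import Data.Nat.Tactic.RingSolver using (solve-∀)
open import Algebra.Properties.Semiring.Sum +-*-semiring
  using (sum-syntax; ∑-distrib-+; *-distribˡ-sum; sum-cong-≗; sum-replicate-zero)
open import Data.Bool using (Bool; true; false; if_then_else_; _∨_; _∧_; not)
open import Data.Bool.Properties using (T-≡)
open import Data.Fin as Fin using (Fin; zero; suc; toℕ; _↑ˡ_; _↑ʳ_)
import Data.Fin.Properties as Fin
open import Data.Fin.Subset using (Subset; _∈_; _∉_; ∣_∣; ⊥; ⊤)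
open import Data.Fin.Subset.Properties using (∉⊥; ∈⊤; ∣⊥∣≡0; ∣⊤∣≡n)
open import Data.Vec using ([]; _∷_; lookup; _++_)
open import Data.Vec.Properties using (lookup⇒[]=; []=⇒lookup; lookup-++ˡ; lookup-++ʳ)
open import Data.List as List using (List; []; _∷_; map; length)
open import Data.List.Properties using (map-++)
open import Data.List.Relation.Unary.All as All using (All; []; _∷_)
import Data.List.Relation.Unary.All.Properties as All
open import Data.List.Relation.Unary.Any as Any using (Any; here; there)
import Data.List.Relation.Unary.Any.Properties as Any
open import Data.Product using (_×_; _,_; proj₁; proj₂; Σ-syntax)
open import Function using (_∘_; Equivalence; mk⇔)
open import Relation.Nullary using (¬_; yes; no; contradiction)
open import Relation.Nullary.Decidable using (does; dec-true; does-⇔)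
open import Relation.Binary.PropositionalEquality

∑-const : ∀ n c → ∑[ i < n ] c ≡ n * c
∑-const zero    c = refl
∑-const (suc n) c = cong (c +_) (∑-const n c)

∑-mono-≤ : ∀ {n} {f g : Fin n → ℕ} → (∀ i → f i ≤ g i) → ∑[ i < n ] f i ≤ ∑[ i < n ] g i
∑-mono-≤ {zero}  f≤g = z≤n
∑-mono-≤ {suc n} f≤g = +-mono-≤ (f≤g zero) (∑-mono-≤ (f≤g ∘ suc))

χ : ∀ {n} → Subset n → Fin n → ℕ
χ p i = if lookup p i then 1 else 0

∣p∣≡∑χ : ∀ {n} (p : Subset n) → ∣ p ∣ ≡ ∑[ i < n ] χ p i
∣p∣≡∑χ []          = refl
∣p∣≡∑χ (true  ∷ p) = cong suc (∣p∣≡∑χ p)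
∣p∣≡∑χ (false ∷ p) = ∣p∣≡∑χ p

2*p≡p+p : ∀ p → 2 * p ≡ p + p
2*p≡p+p p = cong (p +_) (+-identityʳ p)

2*p≤n⇒p≤⌊n/2⌋ : ∀ p {n} → 2 * p ≤ n → p ≤ ⌊ n /2⌋
2*p≤n⇒p≤⌊n/2⌋ p {n} 2p≤n = begin
  p             ≡⟨ n≡⌊n+n/2⌋ p ⟩
  ⌊ p + p /2⌋   ≤⟨ ⌊n/2⌋-mono (subst (_≤ n) (2*p≡p+p p) 2p≤n) ⟩
  ⌊ n /2⌋       ∎
  where open ≤-Reasoning

n≤2*q⇒⌈n/2⌉≤q : ∀ q {n} → n ≤ 2 * q → ⌈ n /2⌉ ≤ q
n≤2*q⇒⌈n/2⌉≤q q {n} n≤2q = begin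
  ⌈ n /2⌉       ≤⟨ ⌈n/2⌉-mono (subst (n ≤_) (2*p≡p+p q) n≤2q) ⟩
  ⌈ q + q /2⌉   ≡⟨ n≡⌈n+n/2⌉ q ⟨
  q             ∎
  where open ≤-Reasoning

p≤⌊n/2⌋⇒2*p≤n : ∀ p {n} → p ≤ ⌊ n /2⌋ → 2 * p ≤ n
p≤⌊n/2⌋⇒2*p≤n p {n} p≤⌊n/2⌋ = begin
  2 * p                   ≤⟨ *-monoʳ-≤ 2 p≤⌊n/2⌋ ⟩
  2 * ⌊ n /2⌋             ≡⟨ 2*p≡p+p ⌊ n /2⌋ ⟩
  ⌊ n /2⌋ + ⌊ n /2⌋       ≤⟨ +-monoʳ-≤ ⌊ n /2⌋ (⌊n/2⌋≤⌈n/2⌉ n) ⟩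
  ⌊ n /2⌋ + ⌈ n /2⌉       ≡⟨ ⌊n/2⌋+⌈n/2⌉≡n n ⟩
  n                       ∎
  where open ≤-Reasoning

⌈n/2⌉≤q⇒n≤2*q : ∀ q {n} → ⌈ n /2⌉ ≤ q → n ≤ 2 * q
⌈n/2⌉≤q⇒n≤2*q q {n} ⌈n/2⌉≤q = begin
  n                       ≡⟨ ⌊n/2⌋+⌈n/2⌉≡n n ⟨
  ⌊ n /2⌋ + ⌈ n /2⌉       ≤⟨ +-monoˡ-≤ ⌈ n /2⌉ (⌊n/2⌋≤⌈n/2⌉ n) ⟩
  ⌈ n /2⌉ + ⌈ n /2⌉       ≤⟨ +-mono-≤ ⌈n/2⌉≤q ⌈n/2⌉≤q ⟩
  q + q                   ≡⟨ 2*p≡p+p q ⟨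
  2 * q                   ∎
  where open ≤-Reasoning

2^⌊log₂n⌋≤n<2^[⌊log₂n⌋+1] : ∀ n → 1 ≤ n → 2 ^ ⌊log₂ n ⌋ ≤ n × n < 2 ^ (⌊log₂ n ⌋ + 1)
2^⌊log₂n⌋≤n<2^[⌊log₂n⌋+1] = <-rec _ bounds
  where
  bounds : ∀ n → (∀ {m} → m < n → 1 ≤ m → 2 ^ ⌊log₂ m ⌋ ≤ m × m < 2 ^ (⌊log₂ m ⌋ + 1)) →
           1 ≤ n → 2 ^ ⌊log₂ n ⌋ ≤ n × n < 2 ^ (⌊log₂ n ⌋ + 1)
  bounds 1                   _   _ = s≤s z≤n , s≤s (s≤s z≤n)
  bounds n@(suc (suc n-2)) rec _ =
    subst (λ k → 2 ^ k ≤ n × n < 2 ^ (k + 1)) (sym ⌊log₂n⌋≡1+⌊log₂⌊n/2⌋⌋)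
          (p≤⌊n/2⌋⇒2*p≤n (2 ^ ⌊log₂ ⌊ n /2⌋ ⌋) (proj₁ half-bounds) ,
           ⌈n/2⌉≤q⇒n≤2*q (2 ^ (⌊log₂ ⌊ n /2⌋ ⌋ + 1)) (proj₂ half-bounds))
    where
    half-bounds : 2 ^ ⌊log₂ ⌊ n /2⌋ ⌋ ≤ ⌊ n /2⌋ × ⌊ n /2⌋ < 2 ^ (⌊log₂ ⌊ n /2⌋ ⌋ + 1)
    half-bounds = rec (⌊n/2⌋<n (suc n-2)) (s≤s z≤n)
    1≤⌊log₂n⌋ : 1 ≤ ⌊log₂ n ⌋
    1≤⌊log₂n⌋ = ⌊log₂⌋-mono-≤ {2} {n} (s≤s (s≤s z≤n))
    ⌊log₂n⌋≡1+⌊log₂⌊n/2⌋⌋ : ⌊log₂ n ⌋ ≡ 1 + ⌊log₂ ⌊ n /2⌋ ⌋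
    ⌊log₂n⌋≡1+⌊log₂⌊n/2⌋⌋ =
      trans (sym (m+[n∸m]≡n 1≤⌊log₂n⌋)) (cong suc (sym (⌊log₂⌊n/2⌋⌋≡⌊log₂n⌋∸1 n)))

-- Lower bound

-- T n i j computes to toℕ i <ᵇ toℕ j.
T≡true⇒< : ∀ {n} {i j : Fin n} → T n i j ≡ true → i Fin.< j
T≡true⇒< {i = i} {j} eq = <ᵇ⇒< (toℕ i) (toℕ j) (Equivalence.from T-≡ eq)

<⇒T≡true : ∀ {n} {i j : Fin n} → i Fin.< j → T n i j ≡ true
<⇒T≡true {i = i} {j} = dec-true (i Fin.<? j)

Disjoint : ∀ {n} → Rect n n → Set
Disjoint (R , C) = ∀ {i} → i ∈ R → i ∉ C

is1Rect⇒disjoint : ∀ {n} {r : Rect n n} → Is1Rect (T n) r → Disjoint r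
is1Rect⇒disjoint {r = R , C} one {i} i∈R i∈C = n≮n (toℕ i) (T≡true⇒< (one i i i∈R i∈C))

degree : ∀ {n} → List (Rect n n) → Fin n → ℕ
degree []             i = 0
degree ((R , C) ∷ rs) i = χ R i + χ C i + degree rs i

misses : ∀ {n} → List (Rect n n) → Fin n → ℕ
misses []             i = 0
misses ((R , C) ∷ rs) i = if lookup R i ∨ lookup C i then misses rs i else suc (misses rs i)

cost≡∑degree : ∀ {n} (rs : List (Rect n n)) → cost rs ≡ ∑[ i < n ] degree rs i
cost≡∑degree {n} []  = sym (sum-replicate-zero n)
cost≡∑degree ((R , C) ∷ rs) = begin
  ∣ R ∣ + ∣ C ∣ + cost rs
    ≡⟨ cong₂ _+_ (cong₂ _+_ (∣p∣≡∑χ R) (∣p∣≡∑χ C)) (cost≡∑degree rs) ⟩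
  ∑[ i < _ ] χ R i + ∑[ i < _ ] χ C i + ∑[ i < _ ] degree rs i
    ≡⟨ cong (_+ ∑[ i < _ ] degree rs i) (sym (∑-distrib-+ (χ R) (χ C))) ⟩
  ∑[ i < _ ] (χ R i + χ C i) + ∑[ i < _ ] degree rs i
    ≡⟨ sym (∑-distrib-+ (λ i → χ R i + χ C i) (degree rs)) ⟩
  ∑[ i < _ ] degree ((R , C) ∷ rs) i ∎
  where open ≡-Reasoning

degree+misses≡length : ∀ {n} {rs : List (Rect n n)} → All Disjoint rs →
                       ∀ i → degree rs i + misses rs i ≡ length rs
degree+misses≡length []                                i = refl
degree+misses≡length {rs = (R , C) ∷ rs} (disj ∷ disjs) i
  with lookup R i in i∈R | lookup C i in i∈C | degree+misses≡length disjs i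
... | true  | true  | _  = contradiction (lookup⇒[]= i C i∈C) (disj (lookup⇒[]= i R i∈R))
... | true  | false | eq = cong suc eq
... | false | true  | eq = cong suc eq
... | false | false | eq = trans (+-suc (degree rs i) (misses rs i)) (cong suc eq)

restrict : ∀ {n} → (Fin n → Bool) → (Fin n → ℕ) → Fin n → ℕ
restrict s f i = if s i then f i else 0

avoiding : ∀ {n} → Subset n → (Fin n → Bool) → Fin n → Bool
avoiding p s i = s i ∧ not (lookup p i)

avoiding⇒∈ : ∀ {n} (p : Subset n) s {i} → avoiding p s i ≡ true → s i ≡ true
avoiding⇒∈ p s {i} eq with s i | eq
... | true | _ = refl

avoiding⇒∉ : ∀ {n} (p : Subset n) s {i} → avoiding p s i ≡ true → i ∉ p
avoiding⇒∉ p s {i} eq i∈p with s i | lookup p i | []=⇒lookup i∈p | eq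
... | true | _ | refl | ()

Separates : ∀ {n} → List (Rect n n) → (Fin n → Bool) → Set
Separates rs s = ∀ {i j} → s i ≡ true → s j ≡ true → i Fin.< j → Any (λ (R , C) → i ∈ R × j ∈ C) rs

separates-avoidingˡ : ∀ {n} {R C : Subset n} {rs s} → Separates ((R , C) ∷ rs) s → Separates rs (avoiding C s)
separates-avoidingˡ {C = C} {s = s} sep si sj i<j
  with sep (avoiding⇒∈ C s si) (avoiding⇒∈ C s sj) i<j
... | here (_ , j∈C) = contradiction j∈C (avoiding⇒∉ C s sj)
... | there sep′     = sep′

separates-avoidingʳ : ∀ {n} {R C : Subset n} {rs s} → Separates ((R , C) ∷ rs) s → Separates rs (avoiding R s)
separates-avoidingʳ {R = R} {s = s} sep si sj i<j
  with sep (avoiding⇒∈ R s si) (avoiding⇒∈ R s sj) i<j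
... | here (i∈R , _) = contradiction i∈R (avoiding⇒∉ R s si)
... | there sep′     = sep′

pairFree⇒∑≤1 : ∀ {n} (s : Fin n → Bool) → (∀ {i j} → s i ≡ true → s j ≡ true → ¬ i Fin.< j) →
               ∑[ i < n ] restrict s (λ _ → 1) i ≤ 1
pairFree⇒∑≤1 {zero}  s pairFree = z≤n
pairFree⇒∑≤1 {suc n} s pairFree with s zero in s₀
... | true  = ≤-reflexive (cong suc (trans (sum-cong-≗ outside) (sum-replicate-zero n)))
  where
  outside : ∀ i → restrict (s ∘ suc) (λ _ → 1) i ≡ 0
  outside i with s (suc i) in sᵢ
  ... | true  = contradiction (s≤s z≤n) (pairFree s₀ sᵢ)
  ... | false = refl
... | false = pairFree⇒∑≤1 (s ∘ suc) (λ {i} {j} si sj i<j → pairFree {suc i} {suc j} si sj (s≤s i<j))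

restrict-split : ∀ {n} {R C : Subset n} {rs} (s : Fin n → Bool) → Disjoint (R , C) → ∀ i →
                 restrict s (λ i → 2 ^ misses ((R , C) ∷ rs) i) i ≡
                 restrict (avoiding C s) (λ i → 2 ^ misses rs i) i +
                 restrict (avoiding R s) (λ i → 2 ^ misses rs i) i
restrict-split {R = R} {C} {rs} s disj i with s i | lookup R i in i∈R | lookup C i in i∈C
... | false | _     | _     = refl
... | true  | true  | true  = contradiction (lookup⇒[]= i C i∈C) (disj (lookup⇒[]= i R i∈R))
... | true  | true  | false = sym (+-identityʳ _)
... | true  | false | true  = refl
... | true  | false | false = cong (2 ^ misses rs i +_) (+-identityʳ _)

-- Kraft's inequality, multiplied by 2 ^ length rs to stay in ℕ: for disjoint rectangles
-- misses rs i = length rs - degree rs i. The first rectangle (R , C) cannot separate two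
-- points both avoiding C, nor two both avoiding R, and a point it misses is counted in
-- both halves, matching the extra factor 2 in its weight.
∑2^misses≤2^length : ∀ {n} (rs : List (Rect n n)) (s : Fin n → Bool) → All Disjoint rs → Separates rs s →
                     ∑[ i < n ] restrict s (λ i → 2 ^ misses rs i) i ≤ 2 ^ length rs
∑2^misses≤2^length [] s [] sep =
  pairFree⇒∑≤1 s (λ si sj i<j → Any.¬Any[] (sep si sj i<j))
∑2^misses≤2^length {n} ((R , C) ∷ rs) s (disj ∷ disjs) sep = begin
  ∑[ i < n ] restrict s (λ i → 2 ^ misses ((R , C) ∷ rs) i) i
    ≡⟨ sum-cong-≗ (restrict-split {rs = rs} s disj) ⟩
  ∑[ i < n ] (restrict (avoiding C s) w i + restrict (avoiding R s) w i)
    ≡⟨ ∑-distrib-+ (restrict (avoiding C s) w) (restrict (avoiding R s) w) ⟩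
  ∑[ i < n ] restrict (avoiding C s) w i + ∑[ i < n ] restrict (avoiding R s) w i
    ≤⟨ +-mono-≤ (∑2^misses≤2^length rs (avoiding C s) disjs (separates-avoidingˡ sep))
                (∑2^misses≤2^length rs (avoiding R s) disjs (separates-avoidingʳ sep)) ⟩
  2 ^ length rs + 2 ^ length rs
    ≡⟨ cong (2 ^ length rs +_) (sym (+-identityʳ _)) ⟩
  2 ^ length ((R , C) ∷ rs) ∎
  where
  open ≤-Reasoning
  w : Fin n → ℕ
  w i = 2 ^ misses rs i

n<2^n : ∀ n → n < 2 ^ n
n<2^n zero    = s≤s z≤n
n<2^n (suc n) = +-mono-≤ (m^n>0 2 n) (≤-trans (n<2^n n) (m≤m+n (2 ^ n) 0))

[m+1]*2^d≤d*2^d+2^m : ∀ m d → (m + 1) * 2 ^ d ≤ d * 2 ^ d + 2 ^ m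
[m+1]*2^d≤d*2^d+2^m m d with d ≤? m
... | no d≰m = ≤-trans (*-monoˡ-≤ (2 ^ d) (subst (_≤ d) (+-comm 1 m) (≰⇒> d≰m))) (m≤m+n (d * 2 ^ d) (2 ^ m))
... | yes d≤m with (e , refl) ← m≤n⇒∃[o]m+o≡n d≤m = begin
  (d + e + 1) * 2 ^ d         ≡⟨ distrib d e (2 ^ d) ⟩
  d * 2 ^ d + suc e * 2 ^ d   ≤⟨ +-monoʳ-≤ (d * 2 ^ d) (*-monoˡ-≤ (2 ^ d) (n<2^n e)) ⟩
  d * 2 ^ d + 2 ^ e * 2 ^ d   ≡⟨ cong (d * 2 ^ d +_) (trans (*-comm (2 ^ e) (2 ^ d)) (sym (^-distribˡ-+-* 2 d e))) ⟩
  d * 2 ^ d + 2 ^ (d + e)     ∎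
  where
  open ≤-Reasoning
  distrib : ∀ d e x → (d + e + 1) * x ≡ d * x + (1 + e) * x
  distrib = solve-∀

k+2≤degree+2^[k+1-degree] : ∀ {n} {rs : List (Rect n n)} → All Disjoint rs → ∀ k i →
                            2 ^ length rs * (k + 2) ≤ 2 ^ length rs * degree rs i + 2 ^ (k + 1) * 2 ^ misses rs i
k+2≤degree+2^[k+1-degree] {rs = rs} disjs k i = begin
  P * (k + 2)
    ≡⟨ cong₂ _*_ (sym 2^d*2^f≡P) (sym (+-assoc k 1 1)) ⟩
  2 ^ d * 2 ^ f * (k + 1 + 1)
    ≡⟨ x*y*z≡y*[z*x] (2 ^ d) (2 ^ f) (k + 1 + 1) ⟩
  2 ^ f * ((k + 1 + 1) * 2 ^ d)
    ≤⟨ *-monoʳ-≤ (2 ^ f) ([m+1]*2^d≤d*2^d+2^m (k + 1) d) ⟩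
  2 ^ f * (d * 2 ^ d + K)
    ≡⟨ y*[z*x+u]≡x*y*z+u*y (2 ^ d) (2 ^ f) d K ⟩
  2 ^ d * 2 ^ f * d + K * 2 ^ f
    ≡⟨ cong (λ x → x * d + K * 2 ^ f) 2^d*2^f≡P ⟩
  P * d + K * 2 ^ f ∎
  where
  open ≤-Reasoning
  P K d f : ℕ
  P = 2 ^ length rs
  K = 2 ^ (k + 1)
  d = degree rs i
  f = misses rs i
  2^d*2^f≡P : 2 ^ d * 2 ^ f ≡ P
  2^d*2^f≡P = trans (sym (^-distribˡ-+-* 2 d f)) (cong (2 ^_) (degree+misses≡length disjs i))
  x*y*z≡y*[z*x] : ∀ x y z → x * y * z ≡ y * (z * x)
  x*y*z≡y*[z*x] = solve-∀
  y*[z*x+u]≡x*y*z+u*y : ∀ x y z u → y * (z * x + u) ≡ x * y * z + u * y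
  y*[z*x+u]≡x*y*z+u*y = solve-∀

cost-lowerBound : ∀ k {n} (rs : List (Rect n n)) → IsCover (T n) rs → n * (k + 2) ≤ 2 ^ (k + 1) + cost rs
cost-lowerBound k {n} rs (ones , covers) = *-cancelˡ-≤ P (begin
  P * (n * (k + 2))
    ≡⟨ trans (x*[y*z]≡y*[x*z] P n (k + 2)) (sym (∑-const n (P * (k + 2)))) ⟩
  ∑[ i < n ] (P * (k + 2))
    ≤⟨ ∑-mono-≤ (k+2≤degree+2^[k+1-degree] disjs k) ⟩
  ∑[ i < n ] (P * degree rs i + K * w i)
    ≡⟨ ∑-distrib-+ (λ i → P * degree rs i) (λ i → K * w i) ⟩
  ∑[ i < n ] (P * degree rs i) + ∑[ i < n ] (K * w i)
    ≡⟨ sym (cong₂ _+_ (*-distribˡ-sum P (degree rs)) (*-distribˡ-sum K w)) ⟩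
  P * ∑[ i < n ] degree rs i + K * ∑[ i < n ] w i
    ≤⟨ +-monoʳ-≤ _ (*-monoʳ-≤ K (∑2^misses≤2^length rs (λ _ → true) disjs separates)) ⟩
  P * ∑[ i < n ] degree rs i + K * P
    ≡⟨ cong (λ c → P * c + K * P) (sym (cost≡∑degree rs)) ⟩
  P * cost rs + K * P
    ≡⟨ x*y+z*x≡x*[z+y] P (cost rs) K ⟩
  P * (K + cost rs) ∎)
  where
  open ≤-Reasoning
  P K : ℕ
  P = 2 ^ length rs
  K = 2 ^ (k + 1)
  instance
    P≢0 : NonZero P
    P≢0 = m^n≢0 2 (length rs)
  w : Fin n → ℕ
  w i = 2 ^ misses rs i
  disjs : All Disjoint rs
  disjs = All.map is1Rect⇒disjoint ones
  separates : Separates rs (λ _ → true)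
  separates _ _ i<j = covers _ _ (<⇒T≡true i<j)
  x*[y*z]≡y*[x*z] : ∀ x y z → x * (y * z) ≡ y * (x * z)
  x*[y*z]≡y*[x*z] = solve-∀
  x*y+z*x≡x*[z+y] : ∀ x y z → x * y + z * x ≡ x * (z + y)
  x*y+z*x≡x*[z+y] = solve-∀

-- Upper bound

∣p++q∣≡∣p∣+∣q∣ : ∀ {a b} (p : Subset a) (q : Subset b) → ∣ p ++ q ∣ ≡ ∣ p ∣ + ∣ q ∣
∣p++q∣≡∣p∣+∣q∣ []          q = refl
∣p++q∣≡∣p∣+∣q∣ (true  ∷ p) q = cong suc (∣p++q∣≡∣p∣+∣q∣ p q)
∣p++q∣≡∣p∣+∣q∣ (false ∷ p) q = ∣p++q∣≡∣p∣+∣q∣ p q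

module _ {a b} (p : Subset a) (q : Subset b) where

  ∈-++⁺ˡ : ∀ {i} → i ∈ p → i ↑ˡ b ∈ p ++ q
  ∈-++⁺ˡ {i} i∈p = lookup⇒[]= (i ↑ˡ b) (p ++ q) (trans (lookup-++ˡ p q i) ([]=⇒lookup i∈p))

  ∈-++⁻ˡ : ∀ {i} → i ↑ˡ b ∈ p ++ q → i ∈ p
  ∈-++⁻ˡ {i} i∈p++q = lookup⇒[]= i p (trans (sym (lookup-++ˡ p q i)) ([]=⇒lookup i∈p++q))

  ∈-++⁺ʳ : ∀ {j} → j ∈ q → a ↑ʳ j ∈ p ++ q
  ∈-++⁺ʳ {j} j∈q = lookup⇒[]= (a ↑ʳ j) (p ++ q) (trans (lookup-++ʳ p q j) ([]=⇒lookup j∈q))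

  ∈-++⁻ʳ : ∀ {j} → a ↑ʳ j ∈ p ++ q → j ∈ q
  ∈-++⁻ʳ {j} j∈p++q = lookup⇒[]= j q (trans (sym (lookup-++ʳ p q j)) ([]=⇒lookup j∈p++q))

data SplitView (a b : ℕ) : Fin (a + b) → Set where
  left  : (i : Fin a) → SplitView a b (i ↑ˡ b)
  right : (j : Fin b) → SplitView a b (a ↑ʳ j)

splitView : ∀ a b (i : Fin (a + b)) → SplitView a b i
splitView zero    b i       = right i
splitView (suc a) b zero    = left zero
splitView (suc a) b (suc i) with splitView a b i
... | left  i′ = left (suc i′)
... | right j  = right j

↑ˡ<↑ʳ : ∀ {a b} (i : Fin a) (j : Fin b) → i ↑ˡ b Fin.< a ↑ʳ j
↑ˡ<↑ʳ {a} {b} i j = subst₂ _<_ (sym (Fin.toℕ-↑ˡ i b)) (sym (Fin.toℕ-↑ʳ a j))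
                          (<-≤-trans (Fin.toℕ<n i) (m≤m+n a (toℕ j)))

-- T n i j unfolds to does (toℕ i <? toℕ j), with ℕ's _<?_.
T-↑ˡ : ∀ {a} b (i j : Fin a) → T (a + b) (i ↑ˡ b) (j ↑ˡ b) ≡ T a i j
T-↑ˡ b i j = cong₂ (λ x y → does (x <? y)) (Fin.toℕ-↑ˡ i b) (Fin.toℕ-↑ˡ j b)

T-↑ʳ : ∀ a {b} (i j : Fin b) → T (a + b) (a ↑ʳ i) (a ↑ʳ j) ≡ T b i j
T-↑ʳ a i j = trans (cong₂ (λ x y → does (x <? y)) (Fin.toℕ-↑ʳ a i) (Fin.toℕ-↑ʳ a j))
                   (does-⇔ (mk⇔ (+-cancelˡ-< a (toℕ i) (toℕ j)) (+-monoʳ-< a))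
                           (a + toℕ i <? a + toℕ j) (i Fin.<? j))

size : ∀ {m n} → Rect m n → ℕ
size (R , C) = ∣ R ∣ + ∣ C ∣

cost-++ : ∀ {n} (xs ys : List (Rect n n)) → cost (xs List.++ ys) ≡ cost xs + cost ys
cost-++ xs ys = trans (cong sum (map-++ size xs ys)) (sum-++ (map size xs) (map size ys))

cost-map : ∀ {m n} (f : Rect m m → Rect n n) → (∀ r → size (f r) ≡ size r) →
           ∀ rs → cost (map f rs) ≡ cost rs
cost-map f size-f []       = refl
cost-map f size-f (r ∷ rs) = cong₂ _+_ (size-f r) (cost-map f size-f rs)

module _ {a b : ℕ} where

  liftˡ : Rect a a → Rect (a + b) (a + b)
  liftˡ (R , C) = R ++ ⊥ , C ++ ⊥

  liftʳ : Rect b b → Rect (a + b) (a + b)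
  liftʳ (R , C) = ⊥ {a} ++ R , ⊥ {a} ++ C

  corner : Rect (a + b) (a + b)
  corner = ⊤ {a} ++ ⊥ {b} , ⊥ {a} ++ ⊤ {b}

  glue : List (Rect a a) → List (Rect b b) → List (Rect (a + b) (a + b))
  glue xs ys = corner ∷ map liftˡ xs List.++ map liftʳ ys

  cost-glue : ∀ xs ys → cost (glue xs ys) ≡ (a + b) + (cost xs + cost ys)
  cost-glue xs ys =
    cong₂ _+_ size-corner (trans (cost-++ (map liftˡ xs) (map liftʳ ys))
                                 (cong₂ _+_ (cost-map liftˡ size-liftˡ xs) (cost-map liftʳ size-liftʳ ys)))
    where
    ∣p++⊥∣≡∣p∣ : (p : Subset a) → ∣ p ++ ⊥ {b} ∣ ≡ ∣ p ∣
    ∣p++⊥∣≡∣p∣ p = trans (∣p++q∣≡∣p∣+∣q∣ p ⊥) (trans (cong (∣ p ∣ +_) (∣⊥∣≡0 b)) (+-identityʳ ∣ p ∣))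
    ∣⊥++p∣≡∣p∣ : (p : Subset b) → ∣ ⊥ {a} ++ p ∣ ≡ ∣ p ∣
    ∣⊥++p∣≡∣p∣ p = trans (∣p++q∣≡∣p∣+∣q∣ (⊥ {a}) p) (cong (_+ ∣ p ∣) (∣⊥∣≡0 a))
    size-liftˡ : ∀ r → size (liftˡ r) ≡ size r
    size-liftˡ (R , C) = cong₂ _+_ (∣p++⊥∣≡∣p∣ R) (∣p++⊥∣≡∣p∣ C)
    size-liftʳ : ∀ r → size (liftʳ r) ≡ size r
    size-liftʳ (R , C) = cong₂ _+_ (∣⊥++p∣≡∣p∣ R) (∣⊥++p∣≡∣p∣ C)
    size-corner : size corner ≡ a + b
    size-corner = cong₂ _+_ (trans (∣p++⊥∣≡∣p∣ ⊤) (∣⊤∣≡n a)) (trans (∣⊥++p∣≡∣p∣ ⊤) (∣⊤∣≡n b))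

  liftˡ-is1Rect : ∀ {r} → Is1Rect (T a) r → Is1Rect (T (a + b)) (liftˡ r)
  liftˡ-is1Rect {R , C} one i j i∈R j∈C with splitView a b i | splitView a b j
  ... | left i′  | left j′  =
    trans (T-↑ˡ b i′ j′) (one i′ j′ (∈-++⁻ˡ R ⊥ i∈R) (∈-++⁻ˡ C ⊥ j∈C))
  ... | right i′ | _        = contradiction (∈-++⁻ʳ R ⊥ i∈R) ∉⊥
  ... | left _   | right j′ = contradiction (∈-++⁻ʳ C ⊥ j∈C) ∉⊥

  liftʳ-is1Rect : ∀ {r} → Is1Rect (T b) r → Is1Rect (T (a + b)) (liftʳ r)
  liftʳ-is1Rect {R , C} one i j i∈R j∈C with splitView a b i | splitView a b j
  ... | right i′ | right j′ =
    trans (T-↑ʳ a i′ j′) (one i′ j′ (∈-++⁻ʳ (⊥ {a}) R i∈R) (∈-++⁻ʳ (⊥ {a}) C j∈C))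
  ... | left i′  | _        = contradiction (∈-++⁻ˡ (⊥ {a}) R i∈R) ∉⊥
  ... | right _  | left j′  = contradiction (∈-++⁻ˡ (⊥ {a}) C j∈C) ∉⊥

  corner-is1Rect : Is1Rect (T (a + b)) corner
  corner-is1Rect i j i∈R j∈C with splitView a b i | splitView a b j
  ... | left i′  | right j′ = <⇒T≡true (↑ˡ<↑ʳ i′ j′)
  ... | right i′ | _        = contradiction (∈-++⁻ʳ (⊤ {a}) (⊥ {b}) i∈R) ∉⊥
  ... | left _   | left j′  = contradiction (∈-++⁻ˡ (⊥ {a}) (⊤ {b}) j∈C) ∉⊥

  glue-covers : ∀ {xs ys} → Covers (T a) xs → Covers (T b) ys → Covers (T (a + b)) (glue xs ys)
  glue-covers {xs} xs-covers ys-covers i j T≡true with splitView a b i | splitView a b j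
  ... | left i′  | left j′  =
    there (Any.++⁺ˡ (Any.map⁺ (Any.map (λ {(R , C)} (i∈R , j∈C) → ∈-++⁺ˡ R ⊥ i∈R , ∈-++⁺ˡ C ⊥ j∈C)
      (xs-covers i′ j′ (trans (sym (T-↑ˡ b i′ j′)) T≡true)))))
  ... | left i′  | right j′ = here (∈-++⁺ˡ (⊤ {a}) (⊥ {b}) ∈⊤ , ∈-++⁺ʳ (⊥ {a}) (⊤ {b}) ∈⊤)
  ... | right i′ | left j′  = contradiction (T≡true⇒< T≡true) (<-asym (↑ˡ<↑ʳ j′ i′))
  ... | right i′ | right j′ =
    there (Any.++⁺ʳ (map liftˡ xs) (Any.map⁺ (Any.map
      (λ {(R , C)} (i∈R , j∈C) → ∈-++⁺ʳ (⊥ {a}) R i∈R , ∈-++⁺ʳ (⊥ {a}) C j∈C)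
      (ys-covers i′ j′ (trans (sym (T-↑ʳ a i′ j′)) T≡true)))))

  glue-isCover : ∀ {xs ys} → IsCover (T a) xs → IsCover (T b) ys → IsCover (T (a + b)) (glue xs ys)
  glue-isCover (xs-ones , xs-covers) (ys-ones , ys-covers) =
    corner-is1Rect ∷ All.++⁺ (All.map⁺ (All.map liftˡ-is1Rect xs-ones))
                             (All.map⁺ (All.map liftʳ-is1Rect ys-ones)) ,
    glue-covers xs-covers ys-covers

TightCover : ℕ → ℕ → Set
TightCover k n = Σ[ rs ∈ List (Rect n n) ] IsCover (T n) rs × 2 ^ (k + 1) + cost rs ≡ n * (k + 2)

glue-tight : ∀ {k a b} → TightCover k a → TightCover k b → TightCover (suc k) (a + b)
glue-tight {k} {a} {b} (xs , xs-cover , xs-cost) (ys , ys-cover , ys-cost) =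
  glue xs ys , glue-isCover xs-cover ys-cover , (begin
    2 ^ (suc k + 1) + cost (glue xs ys)
      ≡⟨ cong (2 ^ (suc k + 1) +_) (cost-glue xs ys) ⟩
    K + (K + 0) + ((a + b) + (cost xs + cost ys))
      ≡⟨ regroup K (a + b) (cost xs) (cost ys) ⟩
    (K + cost xs) + (K + cost ys) + (a + b)
      ≡⟨ cong (λ c → c + (a + b)) (cong₂ _+_ xs-cost ys-cost) ⟩
    a * (k + 2) + b * (k + 2) + (a + b)
      ≡⟨ collect a b k ⟩
    (a + b) * (suc k + 2) ∎)
  where
  open ≡-Reasoning
  K : ℕ
  K = 2 ^ (k + 1)
  regroup : ∀ K s x y → K + (K + 0) + (s + (x + y)) ≡ (K + x) + (K + y) + s
  regroup = solve-∀
  collect : ∀ a b k → a * (k + 2) + b * (k + 2) + (a + b) ≡ (a + b) * (suc k + 2)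
  collect = solve-∀

T₁-isCover : IsCover (T 1) []
T₁-isCover = [] , λ { zero zero () }

tightCover : ∀ k {n} → 2 ^ k ≤ n → n ≤ 2 ^ (k + 1) → TightCover k n
tightCover zero    {1} _ _ = [] , T₁-isCover , refl
tightCover zero    {2} _ _ = glue {1} {1} [] [] , glue-isCover T₁-isCover T₁-isCover , refl
tightCover zero    {suc (suc (suc _))} _ (s≤s (s≤s ()))
tightCover (suc k) {n} lo hi =
  subst (TightCover (suc k)) (⌊n/2⌋+⌈n/2⌉≡n n) (glue-tight (tightCover k lo₁ hi₁) (tightCover k lo₂ hi₂))
  where
  lo₁ : 2 ^ k ≤ ⌊ n /2⌋
  lo₁ = 2*p≤n⇒p≤⌊n/2⌋ (2 ^ k) lo
  hi₂ : ⌈ n /2⌉ ≤ 2 ^ (k + 1)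
  hi₂ = n≤2*q⇒⌈n/2⌉≤q (2 ^ (k + 1)) hi
  lo₂ : 2 ^ k ≤ ⌈ n /2⌉
  lo₂ = ≤-trans lo₁ (⌊n/2⌋≤⌈n/2⌉ n)
  hi₁ : ⌊ n /2⌋ ≤ 2 ^ (k + 1)
  hi₁ = ≤-trans (⌊n/2⌋≤⌈n/2⌉ n) hi₂

corollary5 : (n : ℕ) → n ≥ 1 →
    OR₂≡ (T n) (n * (⌊log₂ n ⌋ + 2) ∸ 2 ^ (⌊log₂ n ⌋ + 1))
corollary5 n n≥1
  with (lo , hi) ← 2^⌊log₂n⌋≤n<2^[⌊log₂n⌋+1] n n≥1
  with (rs , rs-cover , rs-cost) ← tightCover ⌊log₂ n ⌋ lo (<⇒≤ hi) =
  (rs , rs-cover , trans (sym (m+n∸m≡n (2 ^ (⌊log₂ n ⌋ + 1)) (cost rs)))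
                         (cong (_∸ 2 ^ (⌊log₂ n ⌋ + 1)) rs-cost)) ,
  λ rs′ → m≤n+o⇒m∸n≤o _ _ ∘ cost-lowerBound ⌊log₂ n ⌋ rs′
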